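{- Let $n\ge1$, $i\in[n]$, $N\in[2^n]$ and $p=2^i$. Then $$\{\mathcal{S}(c_{i,n},j,N): j\in[2^n]\}=\Big\{a\in\mathbb{Z} : \Big\lfloor\tfrac{N}{p}\Big\rfloor\tfrac{p}{2}+\max\big((N\bmod p)-\tfrac p2,0\big)\ \le a\ \le\ \Big\lfloor\tfrac{N}{p}\Big\rfloor\tfrac{p}{2}+\min\big(N\bmod p,\tfrac p2\big)\Big\}.$$
   Context: For $m\ge0$ and $i\ge1$, $\mathrm{bin}(m,i)$ is the $i$-th bit of $m$ counted from the least significant bit. For $i\in[n]$, $c_{i,n}$ is the $0$-$1$ list of length $2^n$ with $c_{i,n}(j)=\mathrm{bin}(j-1,i)$ (equivalently, $c_{i,n}$ is the block $0^{2^{i-1}}1^{2^{i-1}}$ repeated $2^{n-i}$ times). For a list $L$ of length $m$, $i\in[m]$ and $N\ge1$, the (cyclic) contiguous sum is $\mathcal{S}(L,i,N)=\sum_{j=0}^{N-1}L\big(1+((i+j-1)\bmod m)\big)$. -}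

module Defs where

open import Data.Nat using (ℕ; zero; suc; _+_; _*_; _∸_; _^_; _⊔_; _⊓_)
open import Data.Nat.DivMod using (_/_; _%_)
open import Data.List using (List; []; _∷_; length; upTo; map)
open import Data.Nat.ListAction using (sum)
open import Data.Nat.Properties using (m^n≢0)

_/2^_ : ℕ → ℕ → ℕ
m /2^ k = _/_ m (2 ^ k) ⦃ m^n≢0 2 k ⦄

_%2^_ : ℕ → ℕ → ℕ
m %2^ k = _%_ m (2 ^ k) ⦃ m^n≢0 2 k ⦄

-- bin m i : the i-th bit of m counted from the least significant bit (i ≥ 1);
-- bin m 0 is a junk value (never used).
bin : ℕ → ℕ → ℕ
bin m zero    = 0
bin m (suc i) = (m /2^ i) % 2

-- c i n : the 0-1 list of length 2^n with c(j) = bin (j-1) i, j = 1..2^n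
c : ℕ → ℕ → List ℕ
c i n = map (λ k → bin k i) (upTo (2 ^ n))

-- nth L k : the (k+1)-th entry of L (0 if out of range; never used out of range)
nth : List ℕ → ℕ → ℕ
nth []       _       = 0
nth (x ∷ xs) zero    = x
nth (x ∷ xs) (suc k) = nth xs k

-- cycAt L k = L(1 + (k mod m)) with m = length L (1-indexed entry)
cycAt : List ℕ → ℕ → ℕ
cycAt L k with length L
... | zero  = 0
... | suc m = nth L (k % suc m)

-- S L i N = Σ_{j=0}^{N-1} L(1 + ((i + j - 1) mod m)),  with i ≥ 1
S : List ℕ → ℕ → ℕ → ℕ
S L i N = sum (map (λ j → cycAt L (i + j ∸ 1)) (upTo N))

module Submission where

-- Write i = k + 1, h = 2^k and p = 2^(k+1) = 2h, and let
-- bit k t = ⌊t / h⌋ mod 2.  The entry of c_{i,n} at cyclic (0-based)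
-- position t is bit k t, so S(c_{i,n}, s + 1, N) is the sum of N consecutive
-- terms of the bit sequence starting at s (a "window sum").  The bit
-- sequence is a 0-1 sequence of period p whose period consists of h zeros
-- followed by h ones.  Hence, with N = q p + r and r < p:
--   * a window of length N has sum q h + (window of length r);
--   * a window of length r ≤ p has sum between r ∸ h and min(r, h), the
--     bounds being attained at the starts 0 and h;
--   * moving the start by one changes a window sum of a 0-1 sequence by at
--     most one, so by a discrete intermediate value argument every value in
--     between is attained at some start s ≤ h, i.e. j = s + 1 ≤ 2^n.

open import Defs
open import Data.Nat using (ℕ; _+_; _*_; _∸_; _^_; _⊔_; _⊓_; _≤_)
open import Data.Integer using (ℤ; +_) renaming (_≤_ to _≤ℤ_)
open import Data.Product using (∃-syntax; _×_)
open import Relation.Binary.PropositionalEquality using (_≡_)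
open import Function.Bundles using (_⇔_)

open import Data.Nat using (zero; suc; _<_; z≤n; s≤s; NonZero; >-nonZero⁻¹; s≤s⁻¹; _≤?_)
open import Data.Nat.Properties
open import Data.Nat.DivMod
open import Data.Nat.Divisibility using (divides; divides-refl; ∣-refl)
open import Data.Nat.ListAction using (sum)
open import Data.List using (length; map; upTo; applyUpTo)
open import Data.List.Properties using (length-map; length-applyUpTo)
open import Data.Integer using (-[1+_]; +≤+)
open import Data.Integer.Properties using (+-injective)
open import Data.Product using (_,_)
open import Data.Sum using (inj₁; inj₂)
open import Relation.Binary.PropositionalEquality
  using (refl; sym; trans; cong; cong₂; module ≡-Reasoning)
open import Function.Bundles using (mk⇔; Equivalence)
open import Relation.Nullary using (yes; no)

window : (ℕ → ℕ) → ℕ → ℕ → ℕ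
window g s zero    = 0
window g s (suc N) = g s + window g (suc s) N

window-split : ∀ g s a b → window g s (a + b) ≡ window g s a + window g (s + a) b
window-split g s zero    b = cong (λ x → window g x b) (sym (+-identityʳ s))
window-split g s (suc a) b = begin
  g s + window g (suc s) (a + b)                      ≡⟨ cong (λ x → g s + x) (window-split g (suc s) a b) ⟩
  g s + (window g (suc s) a + window g (suc s + a) b) ≡⟨ +-assoc (g s) _ _ ⟨
  window g s (suc a) + window g (suc (s + a)) b       ≡⟨ cong (λ x → window g s (suc a) + window g x b) (+-suc s a) ⟨
  window g s (suc a) + window g (s + suc a) b         ∎
  where open ≡-Reasoning

window-snoc : ∀ g s N → window g s (suc N) ≡ window g s N + g (s + N)
window-snoc g s N = begin
  window g s (suc N)             ≡⟨ cong (window g s) (+-comm 1 N) ⟩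
  window g s (N + 1)             ≡⟨ window-split g s N 1 ⟩
  window g s N + (g (s + N) + 0) ≡⟨ cong (λ x → window g s N + x) (+-identityʳ _) ⟩
  window g s N + g (s + N)       ∎
  where open ≡-Reasoning

window-const : ∀ g s N v → (∀ t → t < N → g (s + t) ≡ v) → window g s N ≡ N * v
window-const g s zero    v _   = refl
window-const g s (suc N) v g≡v = cong₂ _+_ first (window-const g (suc s) N v rest)
  where
  first : g s ≡ v
  first = trans (cong g (sym (+-identityʳ s))) (g≡v 0 (s≤s z≤n))
  rest : ∀ t → t < N → g (suc s + t) ≡ v
  rest t t<N = trans (cong g (sym (+-suc s t))) (g≡v (suc t) (s≤s t<N))

window-≤ : ∀ g → (∀ t → g t ≤ 1) → ∀ s N → window g s N ≤ N
window-≤ g g≤1 s zero    = z≤n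
window-≤ g g≤1 s (suc N) = +-mono-≤ (g≤1 s) (window-≤ g g≤1 (suc s) N)

window-step : ∀ g → (∀ t → g t ≤ 1) → ∀ s N → window g (suc s) N ≤ suc (window g s N)
window-step g g≤1 s N = begin
  window g (suc s) N       ≤⟨ m≤n+m _ (g s) ⟩
  window g s (suc N)       ≡⟨ window-snoc g s N ⟩
  window g s N + g (s + N) ≤⟨ +-monoʳ-≤ _ (g≤1 (s + N)) ⟩
  window g s N + 1         ≡⟨ +-comm _ 1 ⟩
  suc (window g s N)       ∎
  where open ≤-Reasoning

Periodic : (ℕ → ℕ) → ℕ → Set
Periodic g p = ∀ t → g (p + t) ≡ g t

module _ (g : ℕ → ℕ) (p : ℕ) (periodic : Periodic g p) where

  window-translate : ∀ s r → window g (p + s) r ≡ window g s r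
  window-translate s zero    = refl
  window-translate s (suc r) = cong₂ _+_ (periodic s)
    (trans (cong (λ x → window g x r) (sym (+-suc p s))) (window-translate (suc s) r))

  window-translate* : ∀ m s r → window g (m * p + s) r ≡ window g s r
  window-translate* zero    s r = refl
  window-translate* (suc m) s r = begin
    window g (p + m * p + s) r   ≡⟨ cong (λ x → window g x r) (+-assoc p (m * p) s) ⟩
    window g (p + (m * p + s)) r ≡⟨ window-translate (m * p + s) r ⟩
    window g (m * p + s) r       ≡⟨ window-translate* m s r ⟩
    window g s r                 ∎
    where open ≡-Reasoning

  window-period : ∀ s → window g s p ≡ window g 0 p
  window-period zero    = refl
  window-period (suc s) = trans shift (window-period s)
    where
    shift : window g (suc s) p ≡ window g s p
    shift = +-cancelˡ-≡ (g s) _ _ (begin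
      window g s (suc p)       ≡⟨ window-snoc g s p ⟩
      window g s p + g (s + p) ≡⟨ cong (λ x → window g s p + x) (trans (cong g (+-comm s p)) (periodic s)) ⟩
      window g s p + g s       ≡⟨ +-comm _ (g s) ⟩
      g s + window g s p       ∎)
      where open ≡-Reasoning

  window-periods : ∀ q r s → window g s (q * p + r) ≡ q * window g 0 p + window g s r
  window-periods q r s = begin
    window g s (q * p + r)                   ≡⟨ window-split g s (q * p) r ⟩
    window g s (q * p) + window g (s + q * p) r ≡⟨ cong₂ _+_ (full q s) (trans
                                                   (cong (λ x → window g x r) (+-comm s (q * p)))
                                                   (window-translate* q s r)) ⟩
    q * window g 0 p + window g s r          ∎
    where
    open ≡-Reasoning
    full : ∀ q s → window g s (q * p) ≡ q * window g 0 p
    full zero    s = refl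
    full (suc q) s = trans (window-split g s p (q * p))
                           (cong₂ _+_ (window-period s) (full q (s + p)))

intermediate-value : (g : ℕ → ℕ) (H : ℕ) → (∀ s → s < H → g (suc s) ≤ suc (g s)) →
  ∀ v → g 0 ≤ v → v ≤ g H → ∃[ s ] (s ≤ H × g s ≡ v)
intermediate-value g zero    step v lo hi = 0 , z≤n , ≤-antisym lo hi
intermediate-value g (suc H) step v lo hi with v ≤? g H
... | yes v≤gH with intermediate-value g H (λ s s<H → step s (m<n⇒m<1+n s<H)) v lo v≤gH
...   | s , s≤H , gs≡v = s , m≤n⇒m≤1+n s≤H , gs≡v
intermediate-value g (suc H) step v lo hi | no v≰gH =
  suc H , ≤-refl , ≤-antisym (≤-trans (step H ≤-refl) (≰⇒> v≰gH)) hi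

bit : ℕ → ℕ → ℕ
bit k t = bin t (suc k)

module Bit (k : ℕ) where
  h p : ℕ
  h = 2 ^ k
  p = 2 ^ suc k

  instance
    h≢0 : NonZero h
    h≢0 = m^n≢0 2 k

  p≡h+h : p ≡ h + h
  p≡h+h = cong (λ x → h + x) (+-identityʳ h)

  suc-h≤p : suc h ≤ p
  suc-h≤p = ≤-trans (≤-reflexive (+-comm 1 h))
              (≤-trans (+-monoʳ-≤ h (>-nonZero⁻¹ h)) (≤-reflexive (sym p≡h+h)))

  bit-≤1 : ∀ t → bit k t ≤ 1
  bit-≤1 t = s≤s⁻¹ (m%n<n (t / h) 2)

  -- Adding p = 2h to t adds 2 to ⌊t / h⌋, which does not change its parity.
  bit-periodic : Periodic (bit k) p
  bit-periodic t = begin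
    (p + t) / h % 2      ≡⟨ cong (_% 2) (+-distrib-/-∣ˡ t {h} (divides-refl 2)) ⟩
    (p / h + t / h) % 2  ≡⟨ cong (λ x → (x + t / h) % 2) (m*n/n≡m 2 h) ⟩
    (2 + t / h) % 2      ≡⟨ cong (_% 2) (+-comm 2 (t / h)) ⟩
    (t / h + 2) % 2      ≡⟨ [m+n]%n≡m%n (t / h) 2 ⟩
    t / h % 2            ∎
    where open ≡-Reasoning

  bit-low : ∀ t → t < h → bit k t ≡ 0
  bit-low t t<h = cong (_% 2) (m<n⇒m/n≡0 t<h)

  bit-high : ∀ t → t < h → bit k (h + t) ≡ 1
  bit-high t t<h = cong (_% 2) (begin
    (h + t) / h   ≡⟨ +-distrib-/-∣ˡ t {h} ∣-refl ⟩
    h / h + t / h ≡⟨ cong₂ _+_ (n/n≡1 h) (m<n⇒m/n≡0 t<h) ⟩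
    1             ∎)
    where open ≡-Reasoning

  W : ℕ → ℕ → ℕ
  W = window (bit k)

  W-zeros : ∀ e → e ≤ h → W 0 e ≡ 0
  W-zeros e e≤h = trans (window-const (bit k) 0 e 0 (λ t t<e → bit-low t (<-≤-trans t<e e≤h)))
                        (*-zeroʳ e)

  W-ones : ∀ e → e ≤ h → W h e ≡ e
  W-ones e e≤h = trans (window-const (bit k) h e 1 (λ t t<e → bit-high t (<-≤-trans t<e e≤h)))
                       (*-identityʳ e)

  W-period : ∀ s → W s p ≡ h
  W-period s = begin
    W s p           ≡⟨ window-period (bit k) p bit-periodic s ⟩
    W 0 p           ≡⟨ cong (W 0) p≡h+h ⟩
    W 0 (h + h)     ≡⟨ window-split (bit k) 0 h h ⟩
    W 0 h + W h h   ≡⟨ cong₂ _+_ (W-zeros h ≤-refl) (W-ones h ≤-refl) ⟩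
    h               ∎
    where open ≡-Reasoning

  W-complement : ∀ s r → r ≤ p → W s r + W (s + r) (p ∸ r) ≡ h
  W-complement s r r≤p = begin
    W s r + W (s + r) (p ∸ r) ≡⟨ window-split (bit k) s r (p ∸ r) ⟨
    W s (r + (p ∸ r))         ≡⟨ cong (W s) (m+[n∸m]≡n r≤p) ⟩
    W s p                     ≡⟨ W-period s ⟩
    h                         ∎
    where open ≡-Reasoning

  -- A window of length r ≤ p holds at most r ones and at most the h ones of a period.
  W-upper : ∀ s r → r ≤ p → W s r ≤ r ⊓ h
  W-upper s r r≤p = ⊓-glb (window-≤ (bit k) bit-≤1 s r)
    (≤-trans (m≤m+n (W s r) _) (≤-reflexive (W-complement s r r≤p)))

  -- The complementary window holds at most p ∸ r ones, so this one holds at least h ∸ (p ∸ r) = r ∸ h.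
  W-lower : ∀ s r → r ≤ p → r ∸ h ≤ W s r
  W-lower s r r≤p = m≤n+o⇒m∸n≤o r h (+-cancelʳ-≤ (p ∸ r) r (h + W s r) (begin
    r + (p ∸ r)                     ≡⟨ m+[n∸m]≡n r≤p ⟩
    p                               ≡⟨ p≡h+h ⟩
    h + h                           ≡⟨ cong (λ x → h + x) (W-complement s r r≤p) ⟨
    h + (W s r + W (s + r) (p ∸ r)) ≤⟨ +-monoʳ-≤ h (+-monoʳ-≤ (W s r) (window-≤ (bit k) bit-≤1 (s + r) (p ∸ r))) ⟩
    h + (W s r + (p ∸ r))           ≡⟨ +-assoc h (W s r) (p ∸ r) ⟨
    h + W s r + (p ∸ r)             ∎))
    where open ≤-Reasoning

  W-at-0 : ∀ r → r ≤ p → W 0 r ≡ r ∸ h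
  W-at-0 r r≤p with ≤-total r h
  ... | inj₁ r≤h = trans (W-zeros r r≤h) (sym (m≤n⇒m∸n≡0 r≤h))
  ... | inj₂ h≤r = begin
    W 0 r             ≡⟨ cong (W 0) (m+[n∸m]≡n h≤r) ⟨
    W 0 (h + e)       ≡⟨ window-split (bit k) 0 h e ⟩
    W 0 h + W h e     ≡⟨ cong₂ _+_ (W-zeros h ≤-refl) (W-ones e e≤h) ⟩
    e                 ∎
    where
    open ≡-Reasoning
    e = r ∸ h
    e≤h : e ≤ h
    e≤h = m≤n+o⇒m∸n≤o r h (≤-trans r≤p (≤-reflexive p≡h+h))

  W-at-h : ∀ r → r ≤ p → W h r ≡ r ⊓ h
  W-at-h r r≤p with ≤-total r h
  ... | inj₁ r≤h = trans (W-ones r r≤h) (sym (m≤n⇒m⊓n≡m r≤h))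
  ... | inj₂ h≤r = ≤-antisym (W-upper h r r≤p) (begin
    r ⊓ h                         ≡⟨ m≥n⇒m⊓n≡n h≤r ⟩
    h                             ≡⟨ W-ones h ≤-refl ⟨
    W h h                         ≤⟨ m≤m+n (W h h) _ ⟩
    W h h + W (h + h) (r ∸ h)     ≡⟨ window-split (bit k) h h (r ∸ h) ⟨
    W h (h + (r ∸ h))             ≡⟨ cong (W h) (m+[n∸m]≡n h≤r) ⟩
    W h r                         ∎)
    where open ≤-Reasoning

  W-attains : ∀ r → r ≤ p → ∀ v → r ∸ h ≤ v → v ≤ r ⊓ h → ∃[ s ] (s ≤ h × W s r ≡ v)
  W-attains r r≤p v lo hi =
    intermediate-value (λ s → W s r) h (λ s _ → window-step (bit k) bit-≤1 s r) v
      (≤-trans (≤-reflexive (W-at-0 r r≤p)) lo) (≤-trans hi (≤-reflexive (sym (W-at-h r r≤p))))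

cycAt-mod : ∀ L M .{{_ : NonZero M}} → length L ≡ M → ∀ t → cycAt L t ≡ nth L (t % M)
cycAt-mod L (suc m) len≡ t with length L
cycAt-mod L (suc m) refl t | .(suc m) = refl

nth-map-applyUpTo : ∀ (g f : ℕ → ℕ) M t → t < M → nth (map g (applyUpTo f M)) t ≡ g (f t)
nth-map-applyUpTo g f (suc M) zero    _         = refl
nth-map-applyUpTo g f (suc M) (suc t) (s≤s t<M) = nth-map-applyUpTo g (λ x → f (suc x)) M t t<M

length-c : ∀ i n → length (c i n) ≡ 2 ^ n
length-c i n = trans (length-map _ (upTo (2 ^ n))) (length-applyUpTo _ (2 ^ n))

cycAt-c : ∀ i n t → cycAt (c i n) t ≡ bin (t %2^ n) i
cycAt-c i n t =
  trans (cycAt-mod (c i n) (2 ^ n) {{m^n≢0 2 n}} (length-c i n) t)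
        (nth-map-applyUpTo (λ m → bin m i) (λ m → m) (2 ^ n) (t %2^ n) (m%n<n t (2 ^ n) {{m^n≢0 2 n}}))

%-cong-divisor : ∀ t {a b} .{{_ : NonZero a}} .{{_ : NonZero b}} → a ≡ b → t % a ≡ t % b
%-cong-divisor t refl = refl

bit-mod : ∀ k n t → k < n → bin (t %2^ n) (suc k) ≡ bit k t
bit-mod k n t k<n = begin
  t % 2 ^ n / h % 2        ≡⟨ cong (λ x → x / h % 2) (%-cong-divisor t 2ⁿ≡M*h) ⟩
  t % (M * h) / h % 2      ≡⟨ cong (_% 2) (m%[n*o]/o≡m/o%n t M h) ⟩
  t / h % M % 2            ≡⟨ m∣n⇒o%n%m≡o%m 2 M (t / h) (divides (2 ^ d) (*-comm 2 (2 ^ d))) ⟩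
  t / h % 2                ∎
  where
  open ≡-Reasoning
  d = n ∸ suc k
  h = 2 ^ k
  M = 2 ^ suc d
  instance
    h≢0 : NonZero h
    h≢0 = m^n≢0 2 k
    M≢0 : NonZero M
    M≢0 = m^n≢0 2 (suc d)
    M*h≢0 : NonZero (M * h)
    M*h≢0 = m*n≢0 M h
    2ⁿ≢0 : NonZero (2 ^ n)
    2ⁿ≢0 = m^n≢0 2 n
  2ⁿ≡M*h : 2 ^ n ≡ M * h
  2ⁿ≡M*h = trans (cong (2 ^_) (trans (sym (m∸n+n≡m k<n)) (+-suc d k)))
                 (^-distribˡ-+-* 2 (suc d) k)

sum-applyUpTo-window : ∀ (G f g : ℕ → ℕ) s N → (∀ t → G (f t) ≡ g (s + t)) →
  sum (map G (applyUpTo f N)) ≡ window g s N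
sum-applyUpTo-window G f g s zero    _     = refl
sum-applyUpTo-window G f g s (suc N) terms = cong₂ _+_
  (trans (terms 0) (cong g (+-identityʳ s)))
  (sum-applyUpTo-window G (λ x → f (suc x)) g (suc s) N
    (λ t → trans (terms (suc t)) (cong g (+-suc s t))))

S-c≡window : ∀ k n s N → k < n → S (c (suc k) n) (suc s) N ≡ window (bit k) s N
S-c≡window k n s N k<n = sum-applyUpTo-window (λ j → cycAt (c (suc k) n) (s + j)) (λ j → j) (bit k) s N
  (λ t → trans (cycAt-c (suc k) n (s + t)) (bit-mod k n (s + t) k<n))

S-c-decomposition : ∀ k n s N → k < n →
  S (c (suc k) n) (suc s) N ≡ (N /2^ suc k) * 2 ^ k + window (bit k) s (N %2^ suc k)
S-c-decomposition k n s N k<n = begin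
  S (c (suc k) n) (suc s) N    ≡⟨ S-c≡window k n s N k<n ⟩
  W s N                        ≡⟨ cong (W s) (trans (m≡m%n+[m/n]*n N p) (+-comm r (q * p))) ⟩
  W s (q * p + r)              ≡⟨ window-periods (bit k) p bit-periodic q r s ⟩
  q * W 0 p + W s r            ≡⟨ cong (λ x → q * x + W s r) (W-period 0) ⟩
  q * h + W s r                ∎
  where
  open ≡-Reasoning
  open Bit k
  instance
    p≢0 : NonZero p
    p≢0 = m^n≢0 2 (suc k)
  q r : ℕ
  q = N /2^ suc k
  r = N %2^ suc k

cyclic-sums : ∀ k n N → k < n → ∀ m →
  (∃[ j ] ((1 ≤ j × j ≤ 2 ^ n) × m ≡ S (c (suc k) n) j N))
  ⇔
  ((N /2^ suc k) * 2 ^ k + (N %2^ suc k ∸ 2 ^ k) ≤ m × m ≤ (N /2^ suc k) * 2 ^ k + (N %2^ suc k) ⊓ 2 ^ k)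
cyclic-sums k n N k<n m = mk⇔ to from
  where
  open Bit k
  q r : ℕ
  q = N /2^ suc k
  r = N %2^ suc k
  r≤p : r ≤ p
  r≤p = <⇒≤ (m%n<n N p {{m^n≢0 2 (suc k)}})

  to : ∃[ j ] ((1 ≤ j × j ≤ 2 ^ n) × m ≡ S (c (suc k) n) j N) → q * h + (r ∸ h) ≤ m × m ≤ q * h + r ⊓ h
  to (zero  , (() , _) , _)
  to (suc s , _ , refl) rewrite S-c-decomposition k n s N k<n =
    +-monoʳ-≤ (q * h) (W-lower s r r≤p) , +-monoʳ-≤ (q * h) (W-upper s r r≤p)

  from : q * h + (r ∸ h) ≤ m × m ≤ q * h + r ⊓ h → ∃[ j ] ((1 ≤ j × j ≤ 2 ^ n) × m ≡ S (c (suc k) n) j N)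
  from (lo , hi) with W-attains r r≤p (m ∸ q * h)
                        (m+n≤o⇒m≤o∸n (r ∸ h) (≤-trans (≤-reflexive (+-comm (r ∸ h) (q * h))) lo))
                        (m≤n+o⇒m∸n≤o m (q * h) hi)
  ... | s , s≤h , Ws≡ = suc s , (s≤s z≤n , suc-s≤2ⁿ) , (begin
    m                         ≡⟨ m+[n∸m]≡n (≤-trans (m≤m+n (q * h) _) lo) ⟨
    q * h + (m ∸ q * h)       ≡⟨ cong (λ x → q * h + x) Ws≡ ⟨
    q * h + W s r             ≡⟨ S-c-decomposition k n s N k<n ⟨
    S (c (suc k) n) (suc s) N ∎)
    where
    open ≡-Reasoning
    suc-s≤2ⁿ : suc s ≤ 2 ^ n
    suc-s≤2ⁿ = ≤-trans (s≤s s≤h) (≤-trans suc-h≤p (^-monoʳ-≤ 2 k<n))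

theorem14 : ∀ (n i N : ℕ) → 1 ≤ n → 1 ≤ i → i ≤ n → 1 ≤ N → N ≤ 2 ^ n →
    ∀ (a : ℤ) →
      (∃[ j ] ((1 ≤ j × j ≤ 2 ^ n) × a ≡ + S (c i n) j N))
      ⇔
      ((+ ((N /2^ i) * (2 ^ (i ∸ 1)) + ((N %2^ i) ∸ (2 ^ (i ∸ 1)) ⊔ 0)) ≤ℤ a)
        × (a ≤ℤ + ((N /2^ i) * (2 ^ (i ∸ 1)) + ((N %2^ i) ⊓ (2 ^ (i ∸ 1))))))
theorem14 n zero    N _ () _ _ _ _
theorem14 n (suc k) N _ _ k<n _ _ (+ m)
  rewrite ⊔-identityʳ (N %2^ suc k ∸ 2 ^ k) = mk⇔
    (λ (j , j-range , a≡S) → let lo , hi = to (j , j-range , +-injective a≡S) in +≤+ lo , +≤+ hi)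
    (λ { (+≤+ lo , +≤+ hi) → let j , j-range , m≡S = from (lo , hi) in j , j-range , cong +_ m≡S })
  where open Equivalence (cyclic-sums k n N k<n m)
-- A negative integer is neither a sum of 0-1 entries nor above a natural lower bound.
theorem14 n (suc k) N _ _ _ _ _ -[1+ m ] = mk⇔ (λ { (_ , _ , ()) }) (λ { (() , _) })
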